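{- The axiomatization consisting of A1-4, WIF1, WIF2$'$, W1$'$ and CT1$'$ is sound, ground-complete and $\omega$-complete for BCCS($A$) modulo $\precsim_{\rm WCT}$.
   Context: $A$ is a nonempty countable set of actions, $\tau\notin A$, $A_\tau=A\cup\{\tau\}$. BCCS($A$) terms: $t::=0\mid x\mid\alpha t\mid t+t$ ($x$ a variable, $\alpha\in A_\tau$). Transitions: $\alpha t\xrightarrow{\alpha}t$; if $t\xrightarrow{\alpha}t'$ then $t+u\xrightarrow{\alpha}t'$ and $u+t\xrightarrow{\alpha}t'$. $\Rightarrow$ is the reflexive-transitive closure of $\xrightarrow{\tau}$; $\mathcal{I}(s)=\{\alpha\mid s\xrightarrow{\alpha}\}$. $a_1\cdots a_k\in A^*$ is a weak completed trace of closed $s$ if $s\Rightarrow\xrightarrow{a_1}\Rightarrow\cdots\xrightarrow{a_k}\Rightarrow s'$ with $\mathcal{I}(s')=\emptyset$; $\mathcal{WCT}(s)$ the set. $s_1\precsim_{\rm WCT}s_2$ iff $\mathcal{WCT}(s_1)\subseteq\mathcal{WCT}(s_2)$ and $s_1\xrightarrow{\tau}$ implies $s_2\xrightarrow{\tau}$; on open terms via all closed substitutions. Inequational logic (reflexivity, transitivity, substitution instances, closure under contexts; an equation abbreviates two inequations); sound, ground-complete (closed $p\precsim_{\rm WCT}q$ implies $p\preccurlyeq q$ derivable), $\omega$-complete (if all closed instances derivable then the inequation is). Axioms ($\alpha$ over $A_\tau$): A1: $x+y\approx y+x$; A2: $(x+y)+z\approx x+(y+z)$; A3: $x+x\approx x$;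 A4: $x+0\approx x$; WIF1: $\alpha(\tau x+\tau y)\approx\alpha x+\alpha y$; WIF2$'$: $\tau(x+y)\preccurlyeq\tau x+y$; W1$'$: $x\preccurlyeq\tau x+y$; CT1$'$: $\alpha x\preccurlyeq\alpha x+y$. -}

module Defs where

open import Data.Nat using (ℕ)
open import Data.Empty using (⊥; ⊥-elim)
open import Data.List using (List; []; _∷_)
open import Data.Product using (Σ; ∃; _×_; _,_)
open import Relation.Nullary using (¬_)
open import Relation.Binary.Construct.Closure.ReflexiveTransitive using (Star)
open import Function.Definitions using (Injective)
open import Relation.Binary.PropositionalEquality using (_≡_)

Countable : Set → Set
Countable A = Σ (A → ℕ) (λ f → Injective _≡_ _≡_ f)

module BCCS (A : Set) where

  data Act : Set where
    τ   : Act
    act : A → Act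

  -- BCCS(A) terms over a set V of variables.
  -- Open terms: V = ℕ (countably many variables); closed terms: V = ⊥.
  infixl 6 _⊕_
  data Term (V : Set) : Set where
    𝟘   : Term V
    var : V → Term V
    _·_ : Act → Term V → Term V
    _⊕_ : Term V → Term V → Term V

  OTerm : Set
  OTerm = Term ℕ

  CTerm : Set
  CTerm = Term ⊥

  _[_] : {V W : Set} → Term V → (V → Term W) → Term W
  𝟘 [ σ ] = 𝟘
  var x [ σ ] = σ x
  (α · t) [ σ ] = α · (t [ σ ])
  (t ⊕ u) [ σ ] = (t [ σ ]) ⊕ (u [ σ ])

  embed : CTerm → OTerm
  embed t = t [ (λ ()) ]

  data _—[_]→_ {V : Set} : Term V → Act → Term V → Set where
    pre  : ∀ {α t} → (α · t) —[ α ]→ t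
    sumˡ : ∀ {t u α t'} → t —[ α ]→ t' → (t ⊕ u) —[ α ]→ t'
    sumʳ : ∀ {t u α t'} → t —[ α ]→ t' → (u ⊕ t) —[ α ]→ t'

  τstep : CTerm → CTerm → Set
  τstep s s' = s —[ τ ]→ s'

  _⇒_ : CTerm → CTerm → Set
  _⇒_ = Star τstep

  Init : CTerm → Act → Set
  Init s α = ∃ λ s' → s —[ α ]→ s'

  Stuck : CTerm → Set
  Stuck s = ∀ α → ¬ Init s α

  data WCT : CTerm → List A → Set where
    done : ∀ {s s'} → s ⇒ s' → Stuck s' → WCT s []
    step : ∀ {s s₁ s₂ a w} → s ⇒ s₁ → s₁ —[ act a ]→ s₂ → WCT s₂ w → WCT s (a ∷ w)

  _≾c_ : CTerm → CTerm → Set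
  s₁ ≾c s₂ = (∀ w → WCT s₁ w → WCT s₂ w) × (Init s₁ τ → Init s₂ τ)

  _≾_ : OTerm → OTerm → Set
  t ≾ u = (σ : ℕ → CTerm) → (t [ σ ]) ≾c (u [ σ ])

  x y z : OTerm
  x = var 0
  y = var 1
  z = var 2

  -- the axioms, as inequations l ≼ r; an equation gives both directions
  data Axiom : OTerm → OTerm → Set where
    A1  : Axiom (x ⊕ y) (y ⊕ x)
    A2  : Axiom ((x ⊕ y) ⊕ z) (x ⊕ (y ⊕ z))
    A2⁻ : Axiom (x ⊕ (y ⊕ z)) ((x ⊕ y) ⊕ z)
    A3  : Axiom (x ⊕ x) x
    A3⁻ : Axiom x (x ⊕ x)
    A4  : Axiom (x ⊕ 𝟘) x
    A4⁻ : Axiom x (x ⊕ 𝟘)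
    WIF1  : ∀ α → Axiom (α · ((τ · x) ⊕ (τ · y))) ((α · x) ⊕ (α · y))
    WIF1⁻ : ∀ α → Axiom ((α · x) ⊕ (α · y)) (α · ((τ · x) ⊕ (τ · y)))
    WIF2′ : Axiom (τ · (x ⊕ y)) ((τ · x) ⊕ y)
    W1′   : Axiom x ((τ · x) ⊕ y)
    CT1′  : ∀ α → Axiom (α · x) ((α · x) ⊕ y)

  data _⊢≼_ : OTerm → OTerm → Set where
    ax     : ∀ {l r} → Axiom l r → (σ : ℕ → OTerm) → (l [ σ ]) ⊢≼ (r [ σ ])
    refl≼  : ∀ {t} → t ⊢≼ t
    trans≼ : ∀ {t u v} → t ⊢≼ u → u ⊢≼ v → t ⊢≼ v
    subst≼ : ∀ {t u} → t ⊢≼ u → (σ : ℕ → OTerm) → (t [ σ ]) ⊢≼ (u [ σ ])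
    pre≼   : ∀ {t u} α → t ⊢≼ u → (α · t) ⊢≼ (α · u)
    sum≼   : ∀ {t t' u u'} → t ⊢≼ t' → u ⊢≼ u' → (t ⊕ u) ⊢≼ (t' ⊕ u')

  Sound : Set
  Sound = ∀ t u → t ⊢≼ u → t ≾ u

  GroundComplete : Set
  GroundComplete = ∀ (p q : CTerm) → p ≾c q → embed p ⊢≼ embed q

  OmegaComplete : Set
  OmegaComplete = ∀ (t u : OTerm) →
    ((σ : ℕ → CTerm) → embed (t [ σ ]) ⊢≼ embed (u [ σ ])) → t ⊢≼ u

module Submission where

-- Completeness is proved for open terms directly, through a symbolic
-- Criterion on t and u (OpenTerms): every run of t, spelling a visible trace
-- w, to a top variable x (resp. to an inert term n) is matched by a run of u
-- spelling w to a term with x at the top (resp. to an inert term whose top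
-- variables are among those of n), and an initial τ of t is matched by one of u.
-- Sufficiency (SymbolicCompleteness) is proved by induction on t: t is
-- extended by u, and each summand of t is then absorbed by u; the a-summands
-- are absorbed via a merged weak a-derivative D a u of u, using WIF1.
-- Necessity (Necessity) instantiates the variables by 𝟘 or by long a₀-chains
-- and decomposes the resulting closed traces of u[σ].  Ground and
-- ω-completeness follow: closed instances are open terms, and derivable
-- closed instances are sound (Completeness).

open import Defs
open import Data.Product using (_×_)

open import Data.Nat using (ℕ; zero; suc; _+_; _≤_; z≤n; s≤s)
import Data.Nat as ℕ
open import Data.Nat.Properties using (≤-trans; ≤-refl; ≤-reflexive; m≤m+n; m≤n+m; n≤1+n; n≮n)
open import Data.Empty using (⊥-elim)
open import Data.List using (List; []; _∷_; _++_; replicate; length)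
open import Data.List.Properties using (++-cancelʳ; length-++; length-replicate; ++-identityʳ)
open import Data.Product using (∃; _,_; proj₁; proj₂)
open import Data.Sum using (_⊎_; inj₁; inj₂; map₁) renaming (map to ⊎-map)
open import Relation.Nullary using (¬_; Dec; yes; no)
open import Relation.Binary.Definitions using (DecidableEquality)
open import Relation.Binary.PropositionalEquality using (_≡_; refl; sym; cong; cong₂; subst; subst₂)
open import Relation.Binary.Construct.Closure.ReflexiveTransitive using (ε; _◅_)

module ClosedSemantics (A : Set) where
  open BCCS A

  data WCT⁺ : CTerm → List A → Set where
    τ-first : ∀ {s s' v} → s —[ τ ]→ s' → WCT s' v → WCT⁺ s v
    a-first : ∀ {s s' a v} → s —[ act a ]→ s' → WCT s' v → WCT⁺ s (a ∷ v)

  wct-τ : ∀ {s s' v} → s —[ τ ]→ s' → WCT s' v → WCT s v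
  wct-τ tr (done τs st) = done (tr ◅ τs) st
  wct-τ tr (step τs tr' w) = step (tr ◅ τs) tr' w

  WCT⁺⇒WCT : ∀ {s v} → WCT⁺ s v → WCT s v
  WCT⁺⇒WCT (τ-first tr w) = wct-τ tr w
  WCT⁺⇒WCT (a-first tr w) = step ε tr w

  wct-cases : ∀ {s v} → WCT s v → WCT⁺ s v ⊎ (Stuck s × v ≡ [])
  wct-cases (done ε st) = inj₂ (st , refl)
  wct-cases (done (tr ◅ τs) st) = inj₁ (τ-first tr (done τs st))
  wct-cases (step ε tr w) = inj₁ (a-first tr w)
  wct-cases (step (tr ◅ τs) tr' w) = inj₁ (τ-first tr (step τs tr' w))

  WCT⁺-transfer : ∀ {s s' v} → (∀ {α t} → s —[ α ]→ t → s' —[ α ]→ t) → WCT⁺ s v → WCT⁺ s' v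
  WCT⁺-transfer f (τ-first tr w) = τ-first (f tr) w
  WCT⁺-transfer f (a-first tr w) = a-first (f tr) w

  WCT⁺-⊕-inv : ∀ {s s' v} → WCT⁺ (s ⊕ s') v → WCT⁺ s v ⊎ WCT⁺ s' v
  WCT⁺-⊕-inv (τ-first (sumˡ tr) w) = inj₁ (τ-first tr w)
  WCT⁺-⊕-inv (τ-first (sumʳ tr) w) = inj₂ (τ-first tr w)
  WCT⁺-⊕-inv (a-first (sumˡ tr) w) = inj₁ (a-first tr w)
  WCT⁺-⊕-inv (a-first (sumʳ tr) w) = inj₂ (a-first tr w)

  WCT⁺-𝟘 : ∀ {v} → ¬ WCT⁺ 𝟘 v
  WCT⁺-𝟘 (τ-first () _)
  WCT⁺-𝟘 (a-first () _)

  WCT⁺-[]⇒τ : ∀ {s} → WCT⁺ s [] → Init s τ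
  WCT⁺-[]⇒τ (τ-first tr w) = _ , tr

  stuck-𝟘 : Stuck 𝟘
  stuck-𝟘 _ ()

  stuck-⊕ : ∀ {s s'} → Stuck s → Stuck s' → Stuck (s ⊕ s')
  stuck-⊕ st st' α (_ , sumˡ tr) = st α (_ , tr)
  stuck-⊕ st st' α (_ , sumʳ tr) = st' α (_ , tr)

  stuck-⊕-inv : ∀ {s s'} → Stuck (s ⊕ s') → Stuck s × Stuck s'
  stuck-⊕-inv st = (λ α (_ , tr) → st α (_ , sumˡ tr)) , (λ α (_ , tr) → st α (_ , sumʳ tr))

  prefix-not-stuck : ∀ {α s} → ¬ Stuck (α · s)
  prefix-not-stuck {α} st = st α (_ , pre)

  _◃_ : Act → List A → List A
  τ ◃ v = v
  act a ◃ v = a ∷ v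

  prefix-WCT⁺ : ∀ α {s v} → WCT s v → WCT⁺ (α · s) (α ◃ v)
  prefix-WCT⁺ τ w = τ-first pre w
  prefix-WCT⁺ (act a) w = a-first pre w

  prefix-WCT⁺-inv : ∀ α {s v} → WCT⁺ (α · s) v → ∃ λ v' → v ≡ α ◃ v' × WCT s v'
  prefix-WCT⁺-inv .τ (τ-first pre w) = _ , refl , w
  prefix-WCT⁺-inv .(act _) (a-first pre w) = _ , refl , w

  prefix-WCT-inv : ∀ α {s v} → WCT (α · s) v → ∃ λ v' → v ≡ α ◃ v' × WCT s v'
  prefix-WCT-inv α w with wct-cases w
  ... | inj₁ w⁺ = prefix-WCT⁺-inv α w⁺
  ... | inj₂ (st , _) = ⊥-elim (prefix-not-stuck st)

  WCT-⊕-[] : ∀ {s s'} → WCT s [] → WCT s' [] → WCT (s ⊕ s') []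
  WCT-⊕-[] w w' with wct-cases w | wct-cases w'
  ... | inj₁ w⁺ | _ = WCT⁺⇒WCT (WCT⁺-transfer sumˡ w⁺)
  ... | inj₂ _ | inj₁ w⁺ = WCT⁺⇒WCT (WCT⁺-transfer sumʳ w⁺)
  ... | inj₂ (st , _) | inj₂ (st' , _) = done ε (stuck-⊕ st st')

  ≾c-refl : ∀ {s} → s ≾c s
  ≾c-refl = (λ _ w → w) , (λ i → i)

  ≾c-trans : ∀ {s s' s''} → s ≾c s' → s' ≾c s'' → s ≾c s''
  ≾c-trans (f , g) (f' , g') = (λ v w → f' v (f v w)) , (λ i → g' (g i))

  ≾c-same-transitions : ∀ {s s'} → (∀ {α t} → s —[ α ]→ t → s' —[ α ]→ t) →
                        (∀ {α t} → s' —[ α ]→ t → s —[ α ]→ t) → s ≾c s'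
  ≾c-same-transitions {s} {s'} f g = traces , (λ (_ , tr) → _ , f tr)
    where
    traces : ∀ v → WCT s v → WCT s' v
    traces v w with wct-cases w
    ... | inj₁ w⁺ = WCT⁺⇒WCT (WCT⁺-transfer f w⁺)
    ... | inj₂ (st , refl) = done ε (λ α (_ , tr) → st α (_ , g tr))

  -- ≾c preserves moving traces: the τ-clause of ≾c excludes that the
  -- larger term answers a moving empty trace by being stuck.
  ≾c-WCT⁺ : ∀ {s s' v} → s ≾c s' → WCT⁺ s v → WCT⁺ s' v
  ≾c-WCT⁺ {v = v} (f , g) w⁺ with wct-cases (f v (WCT⁺⇒WCT w⁺))
  ... | inj₁ w⁺' = w⁺'
  ... | inj₂ (st , refl) = ⊥-elim (st τ (g (WCT⁺-[]⇒τ w⁺)))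

  ⊕-mono : ∀ {s₁ s₁' s₂ s₂'} → s₁ ≾c s₁' → s₂ ≾c s₂' → (s₁ ⊕ s₂) ≾c (s₁' ⊕ s₂')
  ⊕-mono {s₁} {s₁'} {s₂} {s₂'} (f₁ , g₁) (f₂ , g₂) = traces , τ-init
    where
    traces : ∀ v → WCT (s₁ ⊕ s₂) v → WCT (s₁' ⊕ s₂') v
    traces v w with wct-cases w
    ... | inj₂ (st , refl) = WCT-⊕-[] (f₁ [] (done ε (proj₁ (stuck-⊕-inv st))))
                                      (f₂ [] (done ε (proj₂ (stuck-⊕-inv st))))
    ... | inj₁ w⁺ with WCT⁺-⊕-inv w⁺
    ... | inj₁ w₁ = WCT⁺⇒WCT (WCT⁺-transfer sumˡ (≾c-WCT⁺ (f₁ , g₁) w₁))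
    ... | inj₂ w₂ = WCT⁺⇒WCT (WCT⁺-transfer sumʳ (≾c-WCT⁺ (f₂ , g₂) w₂))
    τ-init : Init (s₁ ⊕ s₂) τ → Init (s₁' ⊕ s₂') τ
    τ-init (_ , sumˡ tr) = _ , sumˡ (proj₂ (g₁ (_ , tr)))
    τ-init (_ , sumʳ tr) = _ , sumʳ (proj₂ (g₂ (_ , tr)))

  ·-mono : ∀ α {s s'} → s ≾c s' → (α · s) ≾c (α · s')
  ·-mono α {s} {s'} (f , _) = traces , τ-init α
    where
    traces : ∀ v → WCT (α · s) v → WCT (α · s') v
    traces v w with prefix-WCT-inv α w
    ... | v' , refl , w' = WCT⁺⇒WCT (prefix-WCT⁺ α (f v' w'))
    τ-init : ∀ β → Init (β · s) τ → Init (β · s') τ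
    τ-init τ _ = _ , pre
    τ-init (act a) (_ , ())

module Soundness (A : Set) where
  open BCCS A
  open ClosedSemantics A

  ⊕-WCT⁺ : ∀ {s s' v} → WCT⁺ s v ⊎ WCT⁺ s' v → WCT (s ⊕ s') v
  ⊕-WCT⁺ (inj₁ w⁺) = WCT⁺⇒WCT (WCT⁺-transfer sumˡ w⁺)
  ⊕-WCT⁺ (inj₂ w⁺) = WCT⁺⇒WCT (WCT⁺-transfer sumʳ w⁺)

  ⊕-WCT-inv : ∀ {s s' v} → WCT (s ⊕ s') v → WCT s v ⊎ WCT⁺ s' v
  ⊕-WCT-inv w with wct-cases w
  ... | inj₂ (st , refl) = inj₁ (done ε (proj₁ (stuck-⊕-inv st)))
  ... | inj₁ w⁺ with WCT⁺-⊕-inv w⁺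
  ... | inj₁ w₁ = inj₁ (WCT⁺⇒WCT w₁)
  ... | inj₂ w₂ = inj₂ w₂

  τ-choice : ∀ {p q v} → WCT (τ · p ⊕ τ · q) v → WCT p v ⊎ WCT q v
  τ-choice w with ⊕-WCT-inv w
  ... | inj₁ w₁ with prefix-WCT-inv τ w₁
  ...   | _ , refl , w₁' = inj₁ w₁'
  τ-choice w | inj₂ w₂ with prefix-WCT⁺-inv τ w₂
  ...   | _ , refl , w₂' = inj₂ w₂'

  τ-choice⁻ : ∀ {p q v} → WCT p v ⊎ WCT q v → WCT (τ · p ⊕ τ · q) v
  τ-choice⁻ (inj₁ w) = ⊕-WCT⁺ (inj₁ (τ-first pre w))
  τ-choice⁻ (inj₂ w) = ⊕-WCT⁺ (inj₂ (τ-first pre w))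

  ⊕-swap : ∀ {V : Set} {s s' : Term V} {α t} → (s ⊕ s') —[ α ]→ t → (s' ⊕ s) —[ α ]→ t
  ⊕-swap (sumˡ tr) = sumʳ tr
  ⊕-swap (sumʳ tr) = sumˡ tr

  ⊕-reassoc : ∀ {V : Set} {s s' s'' : Term V} {α t} → ((s ⊕ s') ⊕ s'') —[ α ]→ t → (s ⊕ (s' ⊕ s'')) —[ α ]→ t
  ⊕-reassoc (sumˡ (sumˡ tr)) = sumˡ tr
  ⊕-reassoc (sumˡ (sumʳ tr)) = sumʳ (sumˡ tr)
  ⊕-reassoc (sumʳ tr) = sumʳ (sumʳ tr)

  ⊕-reassoc⁻ : ∀ {V : Set} {s s' s'' : Term V} {α t} → (s ⊕ (s' ⊕ s'')) —[ α ]→ t → ((s ⊕ s') ⊕ s'') —[ α ]→ t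
  ⊕-reassoc⁻ (sumˡ tr) = sumˡ (sumˡ tr)
  ⊕-reassoc⁻ (sumʳ (sumˡ tr)) = sumˡ (sumʳ tr)
  ⊕-reassoc⁻ (sumʳ (sumʳ tr)) = sumʳ tr

  ⊕-merge : ∀ {V : Set} {s : Term V} {α t} → (s ⊕ s) —[ α ]→ t → s —[ α ]→ t
  ⊕-merge (sumˡ tr) = tr
  ⊕-merge (sumʳ tr) = tr

  ⊕-𝟘 : ∀ {V : Set} {s : Term V} {α t} → (s ⊕ 𝟘) —[ α ]→ t → s —[ α ]→ t
  ⊕-𝟘 (sumˡ tr) = tr

  WIF1-sound : ∀ α p q → (α · (τ · p ⊕ τ · q)) ≾c (α · p ⊕ α · q)
  WIF1-sound α p q = traces , τ-init α
    where
    traces : ∀ v → WCT (α · (τ · p ⊕ τ · q)) v → WCT (α · p ⊕ α · q) v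
    traces v w with prefix-WCT-inv α w
    ... | _ , refl , w' = ⊕-WCT⁺ (⊎-map (prefix-WCT⁺ α) (prefix-WCT⁺ α) (τ-choice w'))
    τ-init : ∀ β → Init (β · (τ · p ⊕ τ · q)) τ → Init (β · p ⊕ β · q) τ
    τ-init τ _ = _ , sumˡ pre
    τ-init (act a) (_ , ())

  WIF1⁻-sound : ∀ α p q → (α · p ⊕ α · q) ≾c (α · (τ · p ⊕ τ · q))
  WIF1⁻-sound α p q = traces , τ-init α
    where
    traces : ∀ v → WCT (α · p ⊕ α · q) v → WCT (α · (τ · p ⊕ τ · q)) v
    traces v w with ⊕-WCT-inv w
    ... | inj₁ w₁ with prefix-WCT-inv α w₁
    ...   | _ , refl , w₁' = WCT⁺⇒WCT (prefix-WCT⁺ α (τ-choice⁻ (inj₁ w₁')))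
    traces v w | inj₂ w₂ with prefix-WCT⁺-inv α w₂
    ...   | _ , refl , w₂' = WCT⁺⇒WCT (prefix-WCT⁺ α (τ-choice⁻ (inj₂ w₂')))
    τ-init : ∀ β → Init (β · p ⊕ β · q) τ → Init (β · (τ · p ⊕ τ · q)) τ
    τ-init τ _ = _ , pre
    τ-init (act a) (_ , sumˡ ())
    τ-init (act a) (_ , sumʳ ())

  WIF2′-sound : ∀ p q → (τ · (p ⊕ q)) ≾c (τ · p ⊕ q)
  WIF2′-sound p q = traces , (λ _ → _ , sumˡ pre)
    where
    traces : ∀ v → WCT (τ · (p ⊕ q)) v → WCT (τ · p ⊕ q) v
    traces v w with prefix-WCT-inv τ w
    ... | _ , refl , w' = ⊕-WCT⁺ (map₁ (τ-first pre) (⊕-WCT-inv w'))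

  W1′-sound : ∀ p q → p ≾c (τ · p ⊕ q)
  W1′-sound p q = (λ v w → ⊕-WCT⁺ (inj₁ (τ-first pre w))) , (λ _ → _ , sumˡ pre)

  CT1′-sound : ∀ α p q → (α · p) ≾c (α · p ⊕ q)
  CT1′-sound α p q = traces , (λ (_ , tr) → _ , sumˡ tr)
    where
    traces : ∀ v → WCT (α · p) v → WCT (α · p ⊕ q) v
    traces v w with wct-cases w
    ... | inj₁ w⁺ = ⊕-WCT⁺ (inj₁ w⁺)
    ... | inj₂ (st , _) = ⊥-elim (prefix-not-stuck st)

  axiom-sound : ∀ {l r} → Axiom l r → (ρ : ℕ → CTerm) → (l [ ρ ]) ≾c (r [ ρ ])
  axiom-sound A1 ρ = ≾c-same-transitions ⊕-swap ⊕-swap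
  axiom-sound A2 ρ = ≾c-same-transitions ⊕-reassoc ⊕-reassoc⁻
  axiom-sound A2⁻ ρ = ≾c-same-transitions ⊕-reassoc⁻ ⊕-reassoc
  axiom-sound A3 ρ = ≾c-same-transitions ⊕-merge sumˡ
  axiom-sound A3⁻ ρ = ≾c-same-transitions sumˡ ⊕-merge
  axiom-sound A4 ρ = ≾c-same-transitions ⊕-𝟘 sumˡ
  axiom-sound A4⁻ ρ = ≾c-same-transitions sumˡ ⊕-𝟘
  axiom-sound (WIF1 α) ρ = WIF1-sound α (ρ 0) (ρ 1)
  axiom-sound (WIF1⁻ α) ρ = WIF1⁻-sound α (ρ 0) (ρ 1)
  axiom-sound WIF2′ ρ = WIF2′-sound (ρ 0) (ρ 1)
  axiom-sound W1′ ρ = W1′-sound (ρ 0) (ρ 1)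
  axiom-sound (CT1′ α) ρ = CT1′-sound α (ρ 0) (ρ 1)

  subst-comp : ∀ {U V W : Set} (t : Term U) (σ : U → Term V) (ρ : V → Term W) →
               ((t [ σ ]) [ ρ ]) ≡ (t [ (λ n → σ n [ ρ ]) ])
  subst-comp 𝟘 σ ρ = refl
  subst-comp (var x) σ ρ = refl
  subst-comp (α · t) σ ρ = cong (α ·_) (subst-comp t σ ρ)
  subst-comp (t ⊕ u) σ ρ = cong₂ _⊕_ (subst-comp t σ ρ) (subst-comp u σ ρ)

  sound : ∀ {t u} → t ⊢≼ u → t ≾ u
  sound (ax {l} {r} a σ) ρ rewrite subst-comp l σ ρ | subst-comp r σ ρ = axiom-sound a _
  sound refl≼ ρ = ≾c-refl
  sound (trans≼ d e) ρ = ≾c-trans (sound d ρ) (sound e ρ)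
  sound (subst≼ {t} {u} d σ) ρ rewrite subst-comp t σ ρ | subst-comp u σ ρ = sound d _
  sound (pre≼ α d) ρ = ·-mono α (sound d ρ)
  sound (sum≼ d e) ρ = ⊕-mono (sound d ρ) (sound e ρ)

module OpenTerms (A : Set) where
  open BCCS A

  data Summand (s : OTerm) : OTerm → Set where
    here : Summand s s
    left : ∀ {t u} → Summand s t → Summand s (t ⊕ u)
    right : ∀ {t u} → Summand s u → Summand s (t ⊕ u)

  TopVar : OTerm → ℕ → Set
  TopVar t x = Summand (var x) t

  transition-summand : ∀ {t α t'} → t —[ α ]→ t' → Summand (α · t') t
  transition-summand pre = here
  transition-summand (sumˡ tr) = left (transition-summand tr)
  transition-summand (sumʳ tr) = right (transition-summand tr)

  summand-trans : ∀ {s t r} → Summand s t → Summand t r → Summand s r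
  summand-trans i here = i
  summand-trans i (left j) = left (summand-trans i j)
  summand-trans i (right j) = right (summand-trans i j)

  summand-step : ∀ {s t α s'} → Summand s t → s —[ α ]→ s' → t —[ α ]→ s'
  summand-step here tr = tr
  summand-step (left i) tr = sumˡ (summand-step i tr)
  summand-step (right i) tr = sumʳ (summand-step i tr)

  Inert : OTerm → Set
  Inert t = ∀ α t' → ¬ (t —[ α ]→ t')

  inert-⊕ : ∀ {t u} → Inert t → Inert u → Inert (t ⊕ u)
  inert-⊕ it iu α t' (sumˡ tr) = it α t' tr
  inert-⊕ it iu α t' (sumʳ tr) = iu α t' tr

  inert-left : ∀ {t u} → Inert (t ⊕ u) → Inert t
  inert-left i α t' tr = i α t' (sumˡ tr)

  inert-right : ∀ {t u} → Inert (t ⊕ u) → Inert u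
  inert-right i α t' tr = i α t' (sumʳ tr)

  inert-or-moves : (t : OTerm) → Inert t ⊎ (∃ λ α → ∃ λ t' → t —[ α ]→ t')
  inert-or-moves 𝟘 = inj₁ (λ _ _ ())
  inert-or-moves (var x) = inj₁ (λ _ _ ())
  inert-or-moves (α · t) = inj₂ (α , t , pre)
  inert-or-moves (t ⊕ u) with inert-or-moves t | inert-or-moves u
  ... | inj₂ (α , t' , tr) | _ = inj₂ (α , t' , sumˡ tr)
  ... | inj₁ _ | inj₂ (α , t' , tr) = inj₂ (α , t' , sumʳ tr)
  ... | inj₁ it | inj₁ iu = inj₁ (inert-⊕ it iu)

  data Path : OTerm → List A → OTerm → Set where
    stop : ∀ {u} → Path u [] u
    τ-step : ∀ {u u' w n} → u —[ τ ]→ u' → Path u' w n → Path u w n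
    a-step : ∀ {u u' a w n} → u —[ act a ]→ u' → Path u' w n → Path u (a ∷ w) n

  run-to-inert : ∀ t → ∃ λ w → ∃ λ n → Path t w n × Inert n
  run-to-inert 𝟘 = [] , 𝟘 , stop , (λ _ _ ())
  run-to-inert (var x) = [] , var x , stop , (λ _ _ ())
  run-to-inert (τ · t) with run-to-inert t
  ... | w , n , p , i = w , n , τ-step pre p , i
  run-to-inert (act a · t) with run-to-inert t
  ... | w , n , p , i = a ∷ w , n , a-step pre p , i
  run-to-inert (t ⊕ u) with run-to-inert t | run-to-inert u
  ... | w , n , τ-step tr p , i | _ = w , n , τ-step (sumˡ tr) p , i
  ... | w , n , a-step tr p , i | _ = w , n , a-step (sumˡ tr) p , i
  ... | _ , _ , stop , _ | w , n , τ-step tr p , i = w , n , τ-step (sumʳ tr) p , i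
  ... | _ , _ , stop , _ | w , n , a-step tr p , i = w , n , a-step (sumʳ tr) p , i
  ... | _ , _ , stop , it | _ , _ , stop , iu = [] , t ⊕ u , stop , inert-⊕ it iu

  ReachesVar : OTerm → List A → ℕ → Set
  ReachesVar u w x = ∃ λ n → Path u w n × TopVar n x

  ReachesInertWithin : OTerm → List A → OTerm → Set
  ReachesInertWithin u w n = ∃ λ n' → Path u w n' × Inert n' × (∀ y → TopVar n' y → TopVar n y)

  record TraceCover (t u : OTerm) : Set where
    constructor trace-cover
    field
      var-cover : ∀ {w x} → ReachesVar t w x → ReachesVar u w x
      inert-cover : ∀ {w n} → Path t w n → Inert n → ReachesInertWithin u w n

  record Criterion (t u : OTerm) : Set where
    constructor criterion
    field
      traces : TraceCover t u
      τ-cover : ∀ {t'} → t —[ τ ]→ t' → ∃ λ u' → u —[ τ ]→ u'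

module Derivations (A : Set) where
  open BCCS A
  open OpenTerms A

  infixr 4 _⟫_
  _⟫_ : ∀ {t u v} → t ⊢≼ u → u ⊢≼ v → t ⊢≼ v
  _⟫_ = trans≼

  inst : OTerm → OTerm → OTerm → ℕ → OTerm
  inst t u v 0 = t
  inst t u v 1 = u
  inst t u v _ = v

  ⊕-comm : ∀ {t u} → (t ⊕ u) ⊢≼ (u ⊕ t)
  ⊕-comm {t} {u} = ax A1 (inst t u 𝟘)

  ⊕-assoc : ∀ {t u v} → ((t ⊕ u) ⊕ v) ⊢≼ (t ⊕ (u ⊕ v))
  ⊕-assoc {t} {u} {v} = ax A2 (inst t u v)

  ⊕-assoc⁻ : ∀ {t u v} → (t ⊕ (u ⊕ v)) ⊢≼ ((t ⊕ u) ⊕ v)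
  ⊕-assoc⁻ {t} {u} {v} = ax A2⁻ (inst t u v)

  ⊕-idem : ∀ {t} → (t ⊕ t) ⊢≼ t
  ⊕-idem {t} = ax A3 (inst t 𝟘 𝟘)

  ⊕-idem⁻ : ∀ {t} → t ⊢≼ (t ⊕ t)
  ⊕-idem⁻ {t} = ax A3⁻ (inst t 𝟘 𝟘)

  ⊕-unit : ∀ {t} → (t ⊕ 𝟘) ⊢≼ t
  ⊕-unit {t} = ax A4 (inst t 𝟘 𝟘)

  ⊕-unit⁻ : ∀ {t} → t ⊢≼ (t ⊕ 𝟘)
  ⊕-unit⁻ {t} = ax A4⁻ (inst t 𝟘 𝟘)

  wif1 : ∀ α {t u} → (α · (τ · t ⊕ τ · u)) ⊢≼ (α · t ⊕ α · u)
  wif1 α {t} {u} = ax (WIF1 α) (inst t u 𝟘)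

  wif2 : ∀ {t u} → (τ · (t ⊕ u)) ⊢≼ (τ · t ⊕ u)
  wif2 {t} {u} = ax WIF2′ (inst t u 𝟘)

  w1 : ∀ {t u} → t ⊢≼ (τ · t ⊕ u)
  w1 {t} {u} = ax W1′ (inst t u 𝟘)

  ct1 : ∀ α {t u} → (α · t) ⊢≼ (α · t ⊕ u)
  ct1 α {t} {u} = ax (CT1′ α) (inst t u 𝟘)

  congˡ : ∀ {t t' v} → t ⊢≼ t' → (t ⊕ v) ⊢≼ (t' ⊕ v)
  congˡ d = sum≼ d refl≼

  congʳ : ∀ {t t' v} → t ⊢≼ t' → (v ⊕ t) ⊢≼ (v ⊕ t')
  congʳ d = sum≼ refl≼ d

  ⊕-rotate : ∀ {t u v} → ((t ⊕ u) ⊕ v) ⊢≼ ((t ⊕ v) ⊕ u)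
  ⊕-rotate = ⊕-assoc ⟫ congʳ ⊕-comm ⟫ ⊕-assoc⁻

  ⊕-exchange : ∀ {t u v} → (t ⊕ (u ⊕ v)) ⊢≼ (u ⊕ (t ⊕ v))
  ⊕-exchange = ⊕-assoc⁻ ⟫ congˡ ⊕-comm ⟫ ⊕-assoc

  ⊕-medial : ∀ {t u v r} → ((t ⊕ u) ⊕ (v ⊕ r)) ⊢≼ ((t ⊕ v) ⊕ (u ⊕ r))
  ⊕-medial = ⊕-assoc ⟫ congʳ ⊕-exchange ⟫ ⊕-assoc⁻

  τ-intro : ∀ {t} → t ⊢≼ (τ · t)
  τ-intro = w1 ⟫ ⊕-unit

  τ-collapse : ∀ α {t} → (α · (τ · t)) ⊢≼ (α · t)
  τ-collapse α = pre≼ α ⊕-idem⁻ ⟫ wif1 α ⟫ ⊕-idem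

  summand-dup : ∀ {s t} → Summand s t → t ⊢≼ (t ⊕ s)
  summand-dup here = ⊕-idem⁻
  summand-dup (left i) = congˡ (summand-dup i) ⟫ ⊕-rotate
  summand-dup (right i) = congʳ (summand-dup i) ⟫ ⊕-assoc⁻

  summand-merge : ∀ {s t} → Summand s t → (t ⊕ s) ⊢≼ t
  summand-merge here = ⊕-idem
  summand-merge (left i) = ⊕-rotate ⟫ congˡ (summand-merge i)
  summand-merge (right i) = ⊕-assoc ⟫ congʳ (summand-merge i)

  summand-absorb : ∀ {s t} → Summand s t → (s ⊕ t) ⊢≼ t
  summand-absorb i = ⊕-comm ⟫ summand-merge i

  -- By CT1′, a term that can move may be extended by an arbitrary summand.
  extend : ∀ {t α t' v} → t —[ α ]→ t' → t ⊢≼ (t ⊕ v)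
  extend {t} {α} {t'} tr = summand-dup i ⟫ congʳ (ct1 α) ⟫ ⊕-assoc⁻ ⟫ congˡ (summand-merge i)
    where
    i : Summand (α · t') t
    i = transition-summand tr

  τ-absorb : ∀ {v u} → (v ⊕ u) ⊢≼ u → (v ⊕ τ · u) ⊢≼ (τ · u)
  τ-absorb d = congʳ (ct1 τ) ⟫ congʳ ⊕-comm ⟫ ⊕-assoc⁻ ⟫ congˡ d ⟫ congˡ τ-intro ⟫ ⊕-idem

  absorb-via : ∀ {v u α u'} → u —[ α ]→ u' → (v ⊕ α · u') ⊢≼ (α · u') → (v ⊕ u) ⊢≼ u
  absorb-via {u = u} {α} {u'} tr d =
    congʳ (summand-dup i) ⟫ congʳ ⊕-comm ⟫ ⊕-assoc⁻ ⟫ congˡ d ⟫ summand-absorb i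
    where
    i : Summand (α · u') u
    i = transition-summand tr

  τ-redundant : ∀ {u u'} → u —[ τ ]→ u' → (τ · u) ⊢≼ u
  τ-redundant {u} {u'} tr =
    pre≼ τ (summand-dup i ⟫ ⊕-comm) ⟫ wif2 ⟫ congˡ (τ-collapse τ) ⟫ summand-absorb i
    where
    i : Summand (τ · u') u
    i = transition-summand tr

module SymbolicCompleteness (A : Set) (_≟A_ : DecidableEquality A) where
  open BCCS A
  open OpenTerms A
  open Derivations A
  open TraceCover
  open Criterion

  var-absorb : ∀ {u n x} → Path u [] n → TopVar n x → (var x ⊕ u) ⊢≼ u
  var-absorb stop tp = summand-absorb tp
  var-absorb (τ-step tr p) tp = absorb-via tr (τ-absorb (var-absorb p tp))

  τ-run-absorb : ∀ {u u₁ n} → u —[ τ ]→ u₁ → Path u₁ [] n → (τ · n ⊕ u) ⊢≼ u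
  τ-run-absorb tr stop = absorb-via tr ⊕-idem
  τ-run-absorb tr (τ-step tr₁ p) = absorb-via tr (τ-absorb (τ-run-absorb tr₁ p))

  add-inert : ∀ s {t} → Inert s → (∀ y → TopVar s y → TopVar t y) → t ⊢≼ (t ⊕ s)
  add-inert 𝟘 i f = ⊕-unit⁻
  add-inert (var x) i f = summand-dup (f x here)
  add-inert (α · s) i f = ⊥-elim (i α s pre)
  add-inert (s₁ ⊕ s₂) i f =
    add-inert s₁ (inert-left i) (λ y p → f y (left p))
    ⟫ add-inert s₂ (inert-right i) (λ y p → left (f y (right p)))
    ⟫ ⊕-assoc

  absorb-inert : ∀ s {u} → Inert s → (∀ x → TopVar s x → (var x ⊕ u) ⊢≼ u) → (s ⊕ u) ⊢≼ u
  absorb-inert 𝟘 i f = ⊕-comm ⟫ ⊕-unit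
  absorb-inert (var x) i f = f x here
  absorb-inert (α · s) i f = ⊥-elim (i α s pre)
  absorb-inert (s₁ ⊕ s₂) i f =
    ⊕-assoc ⟫ congʳ (absorb-inert s₂ (inert-right i) (λ x p → f x (right p)))
            ⟫ absorb-inert s₁ (inert-left i) (λ x p → f x (left p))

  -- The merged weak a-derivative of u: the sum of τu' over the a-prefix
  -- summands a·u' reachable through τ-prefixes of u; by D-path it has a
  -- τ-step to the end of every weak a-move of u.
  D : A → OTerm → OTerm
  D a 𝟘 = 𝟘
  D a (var _) = 𝟘
  D a (τ · t) = D a t
  D a (act b · t) with a ≟A b
  ... | yes _ = τ · t
  ... | no _ = 𝟘
  D a (t ⊕ u) = D a t ⊕ D a u

  D-step : ∀ {a u t} → u —[ act a ]→ t → D a u —[ τ ]→ t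
  D-step {a} pre with a ≟A a
  ... | yes _ = pre
  ... | no a≢a = ⊥-elim (a≢a refl)
  D-step (sumˡ tr) = sumˡ (D-step tr)
  D-step (sumʳ tr) = sumʳ (D-step tr)

  D-τ-closed : ∀ {a u u' α s} → u —[ τ ]→ u' → D a u' —[ α ]→ s → D a u —[ α ]→ s
  D-τ-closed pre tr = tr
  D-τ-closed (sumˡ tr₀) tr = sumˡ (D-τ-closed tr₀ tr)
  D-τ-closed (sumʳ tr₀) tr = sumʳ (D-τ-closed tr₀ tr)

  D-path : ∀ {a u w n} → Path u (a ∷ w) n → ∃ λ u₂ → (D a u —[ τ ]→ u₂) × Path u₂ w n
  D-path (τ-step tr p) with D-path p
  ... | u₂ , tr₂ , p₂ = u₂ , D-τ-closed tr tr₂ , p₂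
  D-path (a-step tr p) = _ , D-step tr , p

  D-empty-or-moves : ∀ a u → (Inert (D a u) × D a u ⊢≼ 𝟘) ⊎ ∃ λ s → D a u —[ τ ]→ s
  D-empty-or-moves a 𝟘 = inj₁ ((λ _ _ ()) , refl≼)
  D-empty-or-moves a (var x) = inj₁ ((λ _ _ ()) , refl≼)
  D-empty-or-moves a (τ · t) = D-empty-or-moves a t
  D-empty-or-moves a (act b · t) with a ≟A b
  ... | yes _ = inj₂ (t , pre)
  ... | no _ = inj₁ ((λ _ _ ()) , refl≼)
  D-empty-or-moves a (t ⊕ u) with D-empty-or-moves a t | D-empty-or-moves a u
  ... | inj₂ (s , tr) | _ = inj₂ (s , sumˡ tr)
  ... | inj₁ _ | inj₂ (s , tr) = inj₂ (s , sumʳ tr)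
  ... | inj₁ (it , dt) | inj₁ (iu , du) = inj₁ (inert-⊕ it iu , sum≼ dt du ⟫ ⊕-unit)

  -- The key use of WIF1: the merged a-derivative, when non-empty, is absorbed by u.
  D-absorb : ∀ a u {s} → D a u —[ τ ]→ s → (act a · D a u ⊕ u) ⊢≼ u
  D-absorb a 𝟘 ()
  D-absorb a (var x) ()
  D-absorb a (τ · t) tr = τ-absorb (D-absorb a t tr)
  D-absorb a (act b · t) tr with a ≟A b
  D-absorb a (act b · t) tr | yes refl = congˡ (τ-collapse (act a)) ⟫ ⊕-idem
  D-absorb a (act b · t) () | no _
  D-absorb a (t ⊕ u) tr with D-empty-or-moves a t | D-empty-or-moves a u
  ... | inj₂ (_ , tr₁) | inj₂ (_ , tr₂) =
        congˡ (pre≼ (act a) (sum≼ τ-intro τ-intro) ⟫ wif1 (act a)) ⟫ ⊕-medial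
        ⟫ sum≼ (D-absorb a t tr₁) (D-absorb a u tr₂)
  ... | inj₂ (_ , tr₁) | inj₁ (_ , du) =
        congˡ (pre≼ (act a) (congʳ du ⟫ ⊕-unit)) ⟫ ⊕-assoc⁻ ⟫ congˡ (D-absorb a t tr₁)
  ... | inj₁ (_ , dt) | inj₂ (_ , tr₂) =
        congˡ (pre≼ (act a) (congˡ dt ⟫ ⊕-comm ⟫ ⊕-unit)) ⟫ ⊕-exchange ⟫ congʳ (D-absorb a u tr₂)
  D-absorb a (t ⊕ u) (sumˡ tr) | inj₁ (it , _) | inj₁ _ = ⊥-elim (it _ _ tr)
  D-absorb a (t ⊕ u) (sumʳ tr) | inj₁ _ | inj₁ (iu , _) = ⊥-elim (iu _ _ tr)

  cover-after-τ : ∀ {t t' u} → t —[ τ ]→ t' → TraceCover t u → TraceCover t' u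
  cover-after-τ tr c = trace-cover (λ (n , p , tp) → var-cover c (n , τ-step tr p , tp))
                                   (λ p i → inert-cover c (τ-step tr p) i)

  cover-τ-prefix : ∀ {t u} → TraceCover t u → TraceCover t (τ · u)
  cover-τ-prefix {t} {u} c =
    trace-cover (λ r → prefix-var (var-cover c r)) (λ p i → prefix-inert (inert-cover c p i))
    where
    prefix-var : ∀ {w x} → ReachesVar u w x → ReachesVar (τ · u) w x
    prefix-var (n , p , tp) = n , τ-step pre p , tp
    prefix-inert : ∀ {w n} → ReachesInertWithin u w n → ReachesInertWithin (τ · u) w n
    prefix-inert (n' , p , i , tops) = n' , τ-step pre p , i , tops

  cover-after-a : ∀ {t a t' u} → t —[ act a ]→ t' → TraceCover t u → TraceCover t' (D a u)
  cover-after-a {a = a} {u = u} tr c =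
    trace-cover (λ (n , p , tp) → derive-var (var-cover c (n , a-step tr p , tp)))
                (λ p i → derive-inert (inert-cover c (a-step tr p) i))
    where
    derive-var : ∀ {w x} → ReachesVar u (a ∷ w) x → ReachesVar (D a u) w x
    derive-var (n , p , tp) with D-path p
    ... | _ , tr₂ , p₂ = n , τ-step tr₂ p₂ , tp
    derive-inert : ∀ {w n} → ReachesInertWithin u (a ∷ w) n → ReachesInertWithin (D a u) w n
    derive-inert (n' , p , i , tops) with D-path p
    ... | _ , tr₂ , p₂ = n' , τ-step tr₂ p₂ , i , tops

  D-nonempty : ∀ {t a t' u} → t —[ act a ]→ t' → TraceCover t u → ∃ λ s → D a u —[ τ ]→ s
  D-nonempty {t' = t'} tr c with run-to-inert t'
  ... | w , n , p , i with inert-cover c (a-step tr p) i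
  ... | _ , pu , _ with D-path pu
  ... | u₂ , tr₂ , _ = u₂ , tr₂

  top-absorbed : ∀ {t u x} → TraceCover t u → TopVar t x → (var x ⊕ u) ⊢≼ u
  top-absorbed c tx with var-cover c (_ , stop , tx)
  ... | _ , p , tp = var-absorb p tp

  -- An inert t can be extended by any u covering it: u reaches, by τ-steps,
  -- an inert term whose top variables are among those of t.
  inert-extend : ∀ {t u} → Inert t → TraceCover t u → t ⊢≼ (t ⊕ u)
  inert-extend {t} {u} it c with inert-cover c stop it
  ... | n , stop , i , tops = add-inert u i tops
  ... | n , τ-step tr p , i , tops =
        add-inert n i tops ⟫ congʳ τ-intro ⟫ extend (sumʳ pre) ⟫ ⊕-assoc ⟫ congʳ (τ-run-absorb tr p)

  mutual
    -- Sufficiency of the Criterion.  An inert t is first extended by u, a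
    -- moving t by CT1′; then every summand of t is absorbed by u.
    criterion-complete : ∀ t u → Criterion t u → t ⊢≼ u
    criterion-complete t u cr with inert-or-moves t
    ... | inj₁ it = inert-extend it (traces cr) ⟫ absorb-inert t it (λ x tx → top-absorbed (traces cr) tx)
    ... | inj₂ (_ , _ , tr) = extend tr ⟫ absorb t t u here cr

    -- Prefixes: αt ≼ α(τu) ≼ αu, where t ≼ τu holds since τu has a τ-step.
    prefix-complete : ∀ α t u → TraceCover t u → (α · t) ⊢≼ (α · u)
    prefix-complete α t u c =
      pre≼ α (criterion-complete t (τ · u) (criterion (cover-τ-prefix c) (λ _ → u , pre))) ⟫ τ-collapse α

    absorb : ∀ s t u → Summand s t → Criterion t u → (s ⊕ u) ⊢≼ u
    absorb 𝟘 t u i cr = ⊕-comm ⟫ ⊕-unit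
    absorb (var x) t u i cr = top-absorbed (traces cr) i
    absorb (τ · s) t u i cr with τ-cover cr (summand-step i pre)
    ... | _ , tru =
          congˡ (prefix-complete τ s u (cover-after-τ (summand-step i pre) (traces cr)) ⟫ τ-redundant tru)
          ⟫ ⊕-idem
    absorb (act a · s) t u i cr =
      congˡ (prefix-complete (act a) s (D a u) (cover-after-a tr (traces cr)))
      ⟫ D-absorb a u (proj₂ (D-nonempty tr (traces cr)))
      where
      tr : t —[ act a ]→ s
      tr = summand-step i pre
    absorb (s₁ ⊕ s₂) t u i cr =
      ⊕-assoc ⟫ congʳ (absorb s₂ t u (summand-trans (right here) i) cr)
              ⟫ absorb s₁ t u (summand-trans (left here) i) cr

-- Necessity: t ≾ u implies the symbolic Criterion, witnessed by suitable
-- closed instances (a₀ is used to build long visible traces).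
module Necessity (A : Set) (a₀ : A) where
  open BCCS A
  open ClosedSemantics A
  open OpenTerms A

  subst-step : ∀ {t α t'} (σ : ℕ → CTerm) → t —[ α ]→ t' → (t [ σ ]) —[ α ]→ (t' [ σ ])
  subst-step σ pre = pre
  subst-step σ (sumˡ tr) = sumˡ (subst-step σ tr)
  subst-step σ (sumʳ tr) = sumʳ (subst-step σ tr)

  top-step : ∀ {t x α s} {σ : ℕ → CTerm} → TopVar t x → σ x —[ α ]→ s → (t [ σ ]) —[ α ]→ s
  top-step here tr = tr
  top-step (left i) tr = sumˡ (top-step i tr)
  top-step (right i) tr = sumʳ (top-step i tr)

  subst-step-inv : ∀ t {α s} (σ : ℕ → CTerm) → (t [ σ ]) —[ α ]→ s →
                   (∃ λ t' → t —[ α ]→ t' × s ≡ (t' [ σ ])) ⊎ (∃ λ x → TopVar t x × σ x —[ α ]→ s)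
  subst-step-inv 𝟘 σ ()
  subst-step-inv (var x) σ tr = inj₂ (x , here , tr)
  subst-step-inv (α · t) σ pre = inj₁ (t , pre , refl)
  subst-step-inv (t ⊕ u) σ (sumˡ tr) with subst-step-inv t σ tr
  ... | inj₁ (t' , tr' , e) = inj₁ (t' , sumˡ tr' , e)
  ... | inj₂ (x , i , tr') = inj₂ (x , left i , tr')
  subst-step-inv (t ⊕ u) σ (sumʳ tr) with subst-step-inv u σ tr
  ... | inj₁ (t' , tr' , e) = inj₁ (t' , sumʳ tr' , e)
  ... | inj₂ (x , i , tr') = inj₂ (x , right i , tr')

  stuck-subst : ∀ {n} (σ : ℕ → CTerm) → Inert n → (∀ y → TopVar n y → Stuck (σ y)) → Stuck (n [ σ ])
  stuck-subst {n} σ i st α (_ , tr) with subst-step-inv n σ tr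
  ... | inj₁ (n' , tr' , _) = i α n' tr'
  ... | inj₂ (y , tp , tr') = st y tp α (_ , tr')

  stuck-subst-inv : ∀ {n} (σ : ℕ → CTerm) → Stuck (n [ σ ]) → Inert n × (∀ y → TopVar n y → Stuck (σ y))
  stuck-subst-inv σ st = (λ α n' tr → st α (_ , subst-step σ tr)) , (λ y tp α (_ , tr) → st α (_ , top-step tp tr))

  lift-path : ∀ {t w n v} (σ : ℕ → CTerm) → Path t w n → WCT (n [ σ ]) v → WCT (t [ σ ]) (w ++ v)
  lift-path σ stop w = w
  lift-path σ (τ-step tr p) w = wct-τ (subst-step σ tr) (lift-path σ p w)
  lift-path σ (a-step tr p) w = step ε (subst-step σ tr) (lift-path σ p w)

  module Decomposition (σ : ℕ → CTerm) where
    data Split (u : OTerm) (v : List A) : Set where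
      inert-end : ∀ n → Path u v n → Inert n → (∀ y → TopVar n y → Stuck (σ y)) → Split u v
      handoff : ∀ v₁ v₂ n y → v ≡ v₁ ++ v₂ → Path u v₁ n → TopVar n y → WCT⁺ (σ y) v₂ → Split u v

    split-τ : ∀ {u u' v} → u —[ τ ]→ u' → Split u' v → Split u v
    split-τ tr (inert-end n p i st) = inert-end n (τ-step tr p) i st
    split-τ tr (handoff v₁ v₂ n y e p tp w) = handoff v₁ v₂ n y e (τ-step tr p) tp w

    split-a : ∀ {u u' a v} → u —[ act a ]→ u' → Split u' v → Split u (a ∷ v)
    split-a tr (inert-end n p i st) = inert-end n (a-step tr p) i st
    split-a {a = a} tr (handoff v₁ v₂ n y e p tp w) = handoff (a ∷ v₁) v₂ n y (cong (a ∷_) e) (a-step tr p) tp w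

    mutual
      decompose : ∀ u {v} → WCT (u [ σ ]) v → Split u v
      decompose u (done τs st) = decompose-done u τs st
      decompose u (step τs tr w) = decompose-step u τs tr w

      decompose-done : ∀ u {s'} → (u [ σ ]) ⇒ s' → Stuck s' → Split u []
      decompose-done u ε st = inert-end u stop (proj₁ (stuck-subst-inv σ st)) (proj₂ (stuck-subst-inv σ st))
      decompose-done u (tr ◅ τs) st with subst-step-inv u σ tr
      ... | inj₁ (u' , tr' , refl) = split-τ tr' (decompose-done u' τs st)
      ... | inj₂ (y , tp , tr') = handoff [] [] u y refl stop tp (τ-first tr' (done τs st))

      decompose-step : ∀ u {s₁ s₂ a w} → (u [ σ ]) ⇒ s₁ → s₁ —[ act a ]→ s₂ → WCT s₂ w → Split u (a ∷ w)
      decompose-step u ε tr w with subst-step-inv u σ tr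
      ... | inj₁ (u' , tr' , refl) = split-a tr' (decompose u' w)
      ... | inj₂ (y , tp , tr') = handoff [] _ u y refl stop tp (a-first tr' w)
      decompose-step u (tr₀ ◅ τs) tr w with subst-step-inv u σ tr₀
      ... | inj₁ (u' , tr' , refl) = split-τ tr' (decompose-step u' τs tr w)
      ... | inj₂ (y , tp , tr') = handoff [] _ u y refl stop tp (τ-first tr' (step τs tr w))

  open Decomposition

  chain : ℕ → CTerm
  chain zero = 𝟘
  chain (suc N) = act a₀ · chain N

  chain-WCT : ∀ N → WCT (chain N) (replicate N a₀)
  chain-WCT zero = done ε stuck-𝟘
  chain-WCT (suc N) = step ε pre (chain-WCT N)

  mutual
    chain-WCT-inv : ∀ N {v} → WCT (chain N) v → v ≡ replicate N a₀
    chain-WCT-inv N w with wct-cases w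
    ... | inj₁ w⁺ = chain-WCT⁺-inv N w⁺
    chain-WCT-inv zero w | inj₂ (_ , refl) = refl
    chain-WCT-inv (suc N) w | inj₂ (st , _) = ⊥-elim (prefix-not-stuck st)

    chain-WCT⁺-inv : ∀ N {v} → WCT⁺ (chain N) v → v ≡ replicate N a₀
    chain-WCT⁺-inv zero w⁺ = ⊥-elim (WCT⁺-𝟘 w⁺)
    chain-WCT⁺-inv (suc N) (a-first pre w) = cong (a₀ ∷_) (chain-WCT-inv N w)

  depth : OTerm → ℕ
  depth 𝟘 = 0
  depth (var _) = 0
  depth (α · t) = suc (depth t)
  depth (t ⊕ u) = depth t + depth u

  depth-step : ∀ {t α t'} → t —[ α ]→ t' → suc (depth t') ≤ depth t
  depth-step pre = ≤-refl
  depth-step (sumˡ {u = u} tr) = ≤-trans (depth-step tr) (m≤m+n _ (depth u))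
  depth-step (sumʳ {u = u} tr) = ≤-trans (depth-step tr) (m≤n+m _ (depth u))

  path-length : ∀ {u w n} → Path u w n → length w ≤ depth u
  path-length stop = z≤n
  path-length (τ-step tr p) = ≤-trans (path-length p) (≤-trans (n≤1+n _) (depth-step tr))
  path-length (a-step tr p) = ≤-trans (s≤s (path-length p)) (depth-step tr)

  length-padded : ∀ (v : List A) N → N ≤ length (v ++ replicate N a₀)
  length-padded v N rewrite length-++ v {replicate N a₀} | length-replicate N {a₀} = m≤n+m N (length v)

  top-var? : ∀ n y → Dec (TopVar n y)
  top-var? 𝟘 y = no λ ()
  top-var? (var x) y with x ℕ.≟ y
  ... | yes refl = yes here
  ... | no x≢y = no λ { here → x≢y refl }
  top-var? (α · t) y = no λ ()
  top-var? (t ⊕ u) y with top-var? t y | top-var? u y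
  ... | yes p | _ = yes (left p)
  ... | no _ | yes q = yes (right q)
  ... | no ¬p | no ¬q = no λ { (left p) → ¬p p ; (right q) → ¬q q }

  only : ℕ → CTerm → ℕ → CTerm
  only x s y with y ℕ.≟ x
  ... | yes _ = s
  ... | no _ = 𝟘

  only-at : ∀ x s → only x s x ≡ s
  only-at x s with x ℕ.≟ x
  ... | yes _ = refl
  ... | no x≢x = ⊥-elim (x≢x refl)

  only-WCT⁺ : ∀ x s y {v} → WCT⁺ (only x s y) v → y ≡ x × WCT⁺ s v
  only-WCT⁺ x s y w⁺ with y ℕ.≟ x
  ... | yes refl = refl , w⁺
  ... | no _ = ⊥-elim (WCT⁺-𝟘 w⁺)

  outside : OTerm → ℕ → ℕ → CTerm
  outside n N y with top-var? n y
  ... | yes _ = 𝟘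
  ... | no _ = chain N

  outside-top : ∀ {n N y} → TopVar n y → Stuck (outside n N y)
  outside-top {n} {N} {y} tp with top-var? n y
  ... | yes _ = stuck-𝟘
  ... | no ¬tp = ⊥-elim (¬tp tp)

  outside-stuck : ∀ {n N y} → Stuck (outside n (suc N) y) → TopVar n y
  outside-stuck {n} {N} {y} st with top-var? n y
  ... | yes tp = tp
  ... | no _ = ⊥-elim (prefix-not-stuck st)

  outside-WCT⁺ : ∀ n N y {v} → WCT⁺ (outside n N y) v → v ≡ replicate N a₀
  outside-WCT⁺ n N y w⁺ with top-var? n y
  ... | yes _ = ⊥-elim (WCT⁺-𝟘 w⁺)
  ... | no _ = chain-WCT⁺-inv N w⁺

  -- Instantiating every variable by 𝟘 shows that u must match an initial τ of t.
  necessary-τ : ∀ {t u t'} → t ≾ u → t —[ τ ]→ t' → ∃ λ u' → u —[ τ ]→ u'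
  necessary-τ {u = u} le tr with proj₂ (le (λ _ → 𝟘)) (_ , subst-step _ tr)
  ... | _ , tr' with subst-step-inv u _ tr'
  ... | inj₁ (u' , tru , _) = u' , tru
  ... | inj₂ (_ , _ , ())

  -- Replacing x by a chain longer than any run of u forces u to reach x
  -- after the same visible trace.
  necessary-var : ∀ {t u w x} → t ≾ u → ReachesVar t w x → ReachesVar u w x
  necessary-var {t} {u} {w} {x} le (n , p , tp) = from-split (decompose σ u (proj₁ (le σ) _ trace))
    where
    N : ℕ
    N = suc (depth u)
    σ : ℕ → CTerm
    σ = only x (chain N)
    trace : WCT (t [ σ ]) (w ++ replicate N a₀)
    trace = lift-path σ p (WCT⁺⇒WCT (WCT⁺-transfer (top-step tp) chain-at-x))
      where
      chain-at-x : WCT⁺ (σ x) (replicate N a₀)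
      chain-at-x = subst (λ s → WCT⁺ s (replicate N a₀)) (sym (only-at x (chain N)))
                         (a-first pre (chain-WCT (depth u)))
    from-split : Split σ u (w ++ replicate N a₀) → ReachesVar u w x
    from-split (inert-end _ p' _ _) = ⊥-elim (n≮n _ (≤-trans (length-padded w N) (path-length p')))
    from-split (handoff v₁ _ n' y e p' tp' w⁺) with only-WCT⁺ x (chain N) y w⁺
    ... | refl , w⁺' with chain-WCT⁺-inv N w⁺'
    ... | refl with ++-cancelʳ (replicate N a₀) w v₁ e
    ... | refl = n' , p' , tp'

  -- Instantiating the top variables of an inert n by 𝟘 and the others by a
  -- long chain makes w a completed trace of t[σ]; u must then end inertly
  -- after w, with only top variables of n.
  necessary-inert : ∀ {t u w n} → t ≾ u → Path t w n → Inert n → ReachesInertWithin u w n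
  necessary-inert {t} {u} {w} {n} le p i = from-split (decompose σ u (proj₁ (le σ) _ trace))
    where
    N : ℕ
    N = suc (length w)
    σ : ℕ → CTerm
    σ = outside n N
    trace : WCT (t [ σ ]) w
    trace = subst (WCT (t [ σ ])) (++-identityʳ w)
                  (lift-path σ p (done ε (stuck-subst σ i (λ y → outside-top))))
    from-split : Split σ u w → ReachesInertWithin u w n
    from-split (inert-end n' p' i' st) = n' , p' , i' , (λ y tp → outside-stuck (st y tp))
    from-split (handoff v₁ _ _ y e _ _ w⁺) with outside-WCT⁺ n N y w⁺
    ... | refl = ⊥-elim (n≮n _ (≤-trans (length-padded v₁ N) (≤-reflexive (cong length (sym e)))))

  necessity : ∀ {t u} → t ≾ u → Criterion t u
  necessity le = criterion (trace-cover (necessary-var le) (necessary-inert le)) (necessary-τ le)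

countable-≟ : {A : Set} → Countable A → DecidableEquality A
countable-≟ (f , f-injective) a b with f a ℕ.≟ f b
... | yes e = yes (f-injective e)
... | no ne = no (λ e → ne (cong f e))

module Completeness (A : Set) (a₀ : A) (_≟A_ : DecidableEquality A) where
  open BCCS A
  open Soundness A
  open SymbolicCompleteness A _≟A_
  open Necessity A a₀

  completeness : ∀ t u → t ≾ u → t ⊢≼ u
  completeness t u le = criterion-complete t u (necessity le)

  embed-subst : ∀ (p : CTerm) (σ : ℕ → CTerm) → (embed p [ σ ]) ≡ p
  embed-subst 𝟘 σ = refl
  embed-subst (var ()) σ
  embed-subst (α · p) σ = cong (α ·_) (embed-subst p σ)
  embed-subst (p ⊕ q) σ = cong₂ _⊕_ (embed-subst p σ) (embed-subst q σ)

  ground-completeness : GroundComplete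
  ground-completeness p q le =
    completeness (embed p) (embed q) (λ σ → subst₂ _≾c_ (sym (embed-subst p σ)) (sym (embed-subst q σ)) le)

  -- Derivable closed instances are sound, so t ≾ u, so t ≼ u is derivable.
  ω-completeness : OmegaComplete
  ω-completeness t u derivable = completeness t u instances
    where
    instances : t ≾ u
    instances σ = subst₂ _≾c_ (embed-subst (t [ σ ]) (λ _ → 𝟘)) (embed-subst (u [ σ ]) (λ _ → 𝟘))
                         (sound (derivable σ) (λ _ → 𝟘))

theorem4p4 : (A : Set) → A → Countable A →
    BCCS.Sound A × BCCS.GroundComplete A × BCCS.OmegaComplete A
theorem4p4 A a₀ countable = (λ _ _ → sound) , ground-completeness , ω-completeness
  where
  open Soundness A
  open Completeness A a₀ (countable-≟ countable)
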